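{- Let $\Lambda=(B,K,\Theta)$ be a signature with parameter set $A$ and $V$ an $A$-family of bottomed sets. A $V$-minimal bottomed $\Lambda$-algebra is unambiguous if and only if it is regular.
   Context: A signature is a triple $\Lambda=(B,K,\Theta)$ with $B,K$ non-empty sets and $\Theta$ assigning to each $k\in K$ a pair $(\underline{k},\overline{k})$, $\overline{k}\in B$, $\underline{k}:D_k\to B$ with $D_k$ finite. $K_b=\{k:\overline{k}=b\}$; parameter set $A=\{b:K_b=\emptyset\}$. For a $B$-family of sets $X$ and $\gamma:I\to B$ ($I$ finite), $[X]_\gamma$ is the set of maps $v$ on $I$ with $v(\eta)\in X_{\gamma(\eta)}$. A bottomed set is a set with a distinguished element $\bot$. A bottomed $\Lambda$-algebra is $(X,p)$ with $X$ a $B$-family of bottomed sets (bottoms $\bot_b$) and arbitrary maps $p_k:[X]_{\underline{k}}\to X_{\overline{k}}$. It is bound to $V$ if $X_a=V_a$ for all $a\in A$. A family $Z$ with $Z_b\subseteq X_b$ is invariant if $p_k([Z]_{\underline{k}})\subseteq Z_{\overline{k}}$ for all $k$, and bottomed if $\bot_b\in Z_b$ for all $b$; $(X,p)$ is $V$-minimal if it is bound to $V$ and $X$ is the only invariant bottomed family $Z$ with $Z_a=V_a$ for all $a\in A$. $(X,p)$ is regular if for each $b\in B\setminus A$ and each $x\in X_b\setminus\{\bot_b\}$ there exist a unique $k\in K_b$ and a unique $v\in[X]_{\underline{k}}$ with $p_k(v)=x$. $(X,p)$ is unambiguous if for each $b\in B$ and each $x\in X_b\setminus\{\bot_b\}$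 there is at most one $k\in K_b$ with $x\in\mathrm{Im}(p_k)$, and for such $k$ at most one $v\in[X]_{\underline{k}}$ with $x=p_k(v)$. -}

module Defs where

open import Data.Nat using (ℕ)
open import Data.Fin using (Fin)
open import Data.Product using (Σ; _×_; _,_)
open import Relation.Binary.PropositionalEquality using (_≡_; _≢_; subst)
open import Relation.Nullary using (¬_)

-- A signature Λ = (B, K, Θ).  Θ k = (dom k, cod k) with dom k : D_k → B,
-- D_k finite, represented as Fin (arity k).  B and K are non-empty.
record Signature : Set₁ where
  field
    B      : Set
    K      : Set
    b₀     : B
    k₀     : K
    arity  : K → ℕ
    dom    : (k : K) → Fin (arity k) → B
    cod    : K → B

  -- b belongs to the parameter set A  iff  K_b = ∅
  IsParam : B → Set
  IsParam b = ¬ (Σ K λ k → cod k ≡ b)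

Args : {B : Set} (X : B → Set) {n : ℕ} → (Fin n → B) → Set
Args X {n} γ = (i : Fin n) → X (γ i)

record ParamFamily (Λ : Signature) : Set₁ where
  open Signature Λ
  field
    V  : (a : B) → IsParam a → Set
    ⊥V : (a : B) (pa : IsParam a) → V a pa

record BAlgebra (Λ : Signature) : Set₁ where
  open Signature Λ
  field
    X  : B → Set
    ⊥X : (b : B) → X b
    p  : (k : K) → Args X (dom k) → X (cod k)

module _ {Λ : Signature} where
  open Signature Λ

  BoundTo : ParamFamily Λ → BAlgebra Λ → Set₁
  BoundTo 𝒱 𝒳 = (a : B) (pa : IsParam a) →
    Σ (X a ≡ V a pa) λ e → subst (λ T → T) e (⊥X a) ≡ ⊥V a pa
    where open ParamFamily 𝒱
          open BAlgebra 𝒳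

  Minimal : ParamFamily Λ → BAlgebra Λ → Set₁
  Minimal 𝒱 𝒳 = BoundTo 𝒱 𝒳 ×
    ((Z : (b : B) → X b → Set) →
     ((k : K) (v : Args X (dom k)) → ((i : Fin (arity k)) → Z (dom k i) (v i)) →
        Z (cod k) (p k v)) →
     ((b : B) → Z b (⊥X b)) →
     ((a : B) → IsParam a → (x : X a) → Z a x) →
     (b : B) (x : X b) → Z b x)
    where open BAlgebra 𝒳

  Regular : BAlgebra Λ → Set
  Regular 𝒳 = (b : B) → ¬ IsParam b → (x : X b) → x ≢ ⊥X b →
    Σ K λ k → Σ (cod k ≡ b) λ e → Σ (Args X (dom k)) λ v →
      (subst X e (p k v) ≡ x)
      × ((k' : K) (e' : cod k' ≡ b) (v' : Args X (dom k')) →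
           subst X e' (p k' v') ≡ x → k' ≡ k)
      × ((v' : Args X (dom k)) → subst X e (p k v') ≡ x → v' ≡ v)
    where open BAlgebra 𝒳

  Unambiguous : BAlgebra Λ → Set
  Unambiguous 𝒳 = (b : B) (x : X b) → x ≢ ⊥X b →
    ((k k' : K) (e : cod k ≡ b) (e' : cod k' ≡ b)
     (v : Args X (dom k)) (v' : Args X (dom k')) →
       subst X e (p k v) ≡ x → subst X e' (p k' v') ≡ x → k ≡ k')
    × ((k : K) (e : cod k ≡ b) (v v' : Args X (dom k)) →
       subst X e (p k v) ≡ x → subst X e (p k v') ≡ x → v ≡ v')
    where open BAlgebra 𝒳

-- In a V-minimal algebra every element is a bottom, a parameter, or a value of
-- some operation, since these elements form an invariant bottomed subfamily.
-- So at a non-parameter sort every non-bottom element has a preimage, and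
-- regularity is exactly existence plus the uniqueness demanded by
-- unambiguity; conversely regularity applies to any non-bottom element with a
-- preimage, because a sort that is the codomain of an operation is not a
-- parameter.
module Submission where

open import Defs
open import Function.Bundles using (_⇔_; mk⇔)
open import Data.Product using (Σ; _,_)
open import Data.Sum using (_⊎_; inj₁; inj₂)
open import Data.Empty using (⊥-elim)
open import Relation.Nullary using (¬_)
open import Relation.Binary.PropositionalEquality using (_≡_; refl; sym; trans; subst)

module _ {Λ : Signature} (𝒳 : BAlgebra Λ) where
  open Signature Λ
  open BAlgebra 𝒳

  Preimage : (b : B) → X b → K → Set
  Preimage b x k = Σ (cod k ≡ b) λ e → Σ (Args X (dom k)) λ v → subst X e (p k v) ≡ x

  InImage : (b : B) → X b → Set
  InImage b x = Σ K (Preimage b x)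

  inImage⇒¬IsParam : {b : B} {x : X b} → InImage b x → ¬ IsParam b
  inImage⇒¬IsParam (k , e , _) isParam = isParam (k , e)

  ArgsUniqueAt : (b : B) → X b → (k : K) → cod k ≡ b → Set
  ArgsUniqueAt b x k e = (v v' : Args X (dom k)) →
    subst X e (p k v) ≡ x → subst X e (p k v') ≡ x → v ≡ v'

  argsUniqueAt-cong : {b : B} {x : X b} {k k₀ : K} → k ≡ k₀ →
    (e : cod k ≡ b) (e₀ : cod k₀ ≡ b) (v₀ : Args X (dom k₀)) →
    ((v : Args X (dom k₀)) → subst X e₀ (p k₀ v) ≡ x → v ≡ v₀) →
    ArgsUniqueAt b x k e
  argsUniqueAt-cong refl refl refl v₀ allEqual v v' h h' =
    trans (allEqual v h) (sym (allEqual v' h'))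

  regular⇒unambiguous : Regular 𝒳 → Unambiguous 𝒳
  regular⇒unambiguous regular b x x≢⊥ = uniqueOp , uniqueArgs
    where
    uniqueOp : (k k' : K) (e : cod k ≡ b) (e' : cod k' ≡ b)
      (v : Args X (dom k)) (v' : Args X (dom k')) →
      subst X e (p k v) ≡ x → subst X e' (p k' v') ≡ x → k ≡ k'
    uniqueOp k k' e e' v v' h h'
      with regular b (inImage⇒¬IsParam (k , e , v , h)) x x≢⊥
    ... | _ , _ , _ , _ , opUnique , _ =
      trans (opUnique k e v h) (sym (opUnique k' e' v' h'))

    uniqueArgs : (k : K) (e : cod k ≡ b) → ArgsUniqueAt b x k e
    uniqueArgs k e v v' h h'
      with regular b (inImage⇒¬IsParam (k , e , v , h)) x x≢⊥
    ... | _ , e₀ , v₀ , _ , opUnique , argsUnique =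
      argsUniqueAt-cong (opUnique k e v h) e e₀ v₀ argsUnique v v' h h'

  module _ (𝒱 : ParamFamily Λ) where

    minimal⇒bottom⊎param⊎inImage : Minimal 𝒱 𝒳 →
      (b : B) (x : X b) → x ≡ ⊥X b ⊎ IsParam b ⊎ InImage b x
    minimal⇒bottom⊎param⊎inImage (_ , induction) =
      induction (λ b x → x ≡ ⊥X b ⊎ IsParam b ⊎ InImage b x)
        (λ k v _ → inj₂ (inj₂ (k , refl , v , refl)))
        (λ b → inj₁ refl)
        (λ a isParam x → inj₂ (inj₁ isParam))

    minimal∧unambiguous⇒regular : Minimal 𝒱 𝒳 → Unambiguous 𝒳 → Regular 𝒳
    minimal∧unambiguous⇒regular minimal unambiguous b ¬isParam x x≢⊥
      with minimal⇒bottom⊎param⊎inImage minimal b x | unambiguous b x x≢⊥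
    ... | inj₁ x≡⊥ | _ = ⊥-elim (x≢⊥ x≡⊥)
    ... | inj₂ (inj₁ isParam) | _ = ⊥-elim (¬isParam isParam)
    ... | inj₂ (inj₂ (k , e , v , h)) | uniqueOp , uniqueArgs =
      k , e , v , h ,
      (λ k' e' v' h' → uniqueOp k' k e' e v' v h' h) ,
      (λ v' h' → uniqueArgs k e v' v h' h)

lemma3p2p3 : (Λ : Signature) (𝒱 : ParamFamily Λ) (𝒳 : BAlgebra Λ) →
    Minimal 𝒱 𝒳 → (Unambiguous 𝒳 ⇔ Regular 𝒳)
lemma3p2p3 Λ 𝒱 𝒳 minimal =
  mk⇔ (minimal∧unambiguous⇒regular 𝒳 𝒱 minimal) (regular⇒unambiguous 𝒳)
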